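{- Let $t\ge 3$ and let $\ell_1,\ldots,\ell_t\ge 2$ be integers, not necessarily sorted. Then $p(\ell_1,\ldots,\ell_t)\le p(\ell_1,\ldots,\ell_{t-1})$. Moreover, equality holds if $\ell_t\ge p(\ell_1,\ldots,\ell_{t-1})$.
   Context: $P_m$ denotes the path with $m$ vertices. For integers $k\ge 2$ and $\ell_1,\ldots,\ell_k\ge 2$, $p(\ell_1,\ldots,\ell_k)$ denotes the least integer $n$ such that for every colouring of the edges of $K_n$ with colours $1,\ldots,k$ there is some $i\in\{1,\ldots,k\}$ and a copy of $P_{\ell_i}$ in $K_n$ none of whose edges has colour $i$. -}

module Defs where

open import Data.Nat using (ℕ; suc; _≤_; _<_)
open import Data.Fin using (Fin; toℕ; inject₁; fromℕ)
open import Data.Product using (Σ; _×_)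
open import Relation.Binary.PropositionalEquality using (_≡_; _≢_)
open import Relation.Nullary using (¬_)
open import Function.Definitions using (Injective)

-- An edge colouring of the complete graph K_n (vertex set Fin n) with k colours
-- (colours Fin k, i.e. 0..k-1 stand for 1..k).  The value on the diagonal
-- c v v is irrelevant; the colouring must be symmetric.
record Colouring (n k : ℕ) : Set where
  field
    col  : Fin n → Fin n → Fin k
    symm : ∀ u v → col u v ≡ col v u
open Colouring public

record AvoidingPath {n k : ℕ} (c : Colouring n k) (i : Fin k) (m : ℕ) : Set where
  field
    vert  : Fin m → Fin n
    inj   : Injective _≡_ _≡_ vert
    avoid : ∀ (j j′ : Fin m) → toℕ j′ ≡ suc (toℕ j) → col c (vert j) (vert j′) ≢ i

Good : {k : ℕ} → (Fin k → ℕ) → ℕ → Set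
Good {k} ℓ n = (c : Colouring n k) → Σ (Fin k) (λ i → AvoidingPath c i (ℓ i))

-- IsP ℓ n : n = p(ℓ_1,…,ℓ_k), i.e. n is the least integer with the property.
IsP : {k : ℕ} → (Fin k → ℕ) → ℕ → Set
IsP ℓ n = Good ℓ n × (∀ m → m < n → ¬ Good ℓ m)

initℓ : {s : ℕ} → (Fin (suc s) → ℕ) → Fin s → ℕ
initℓ ℓ j = ℓ (inject₁ j)

lastℓ : {s : ℕ} → (Fin (suc s) → ℕ) → ℕ
lastℓ {s} ℓ = ℓ (fromℕ s)

-- Merging the colours t-1 and t of a t-colouring gives a (t-1)-colouring; a path avoiding
-- colour i in the merged colouring avoids colour i in the original one, so p(ℓ₁,…,ℓ_t) is
-- at most p(ℓ₁,…,ℓ_{t-1}).  Conversely, a (t-1)-colouring of K_n is a t-colouring in which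
-- colour t is unused; if n < ℓ_t there is no room for a path on ℓ_t vertices, so the path
-- promised by Good must avoid one of the first t-1 colours.
module Submission where

open import Defs
open import Data.Nat using (ℕ; zero; suc; _≤_; _<_)
open import Data.Nat.Properties using (≤-antisym; ≮⇒≥; <⇒≱; <-≤-trans)
open import Data.Fin using (Fin; inject₁; fromℕ) renaming (zero to fzero; suc to fsuc)
open import Data.Fin.Properties using (injective⇒≤)
open import Data.Product using (_×_; _,_; Σ)
open import Data.Sum using (_⊎_; inj₁; inj₂)
open import Relation.Binary.PropositionalEquality using (_≡_; refl; cong)
open import Relation.Nullary using (contradiction)

recolour : ∀ {n k k′} → (Fin k → Fin k′) → Colouring n k → Colouring n k′
recolour f c = record { col = λ u v → f (col c u v) ; symm = λ u v → cong f (symm c u v) }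

AvoidingPath-recolour : ∀ {n k k′ m} (f : Fin k → Fin k′) (c : Colouring n k) {i i′} →
                        f i ≡ i′ → AvoidingPath (recolour f c) i′ m → AvoidingPath c i m
AvoidingPath-recolour f c refl p = record
  { vert = vert ; inj = inj ; avoid = λ j j′ e colour≡i → avoid j j′ e (cong f colour≡i) }
  where open AvoidingPath p

AvoidingPath⇒≤ : ∀ {n k m} {c : Colouring n k} {i : Fin k} → AvoidingPath c i m → m ≤ n
AvoidingPath⇒≤ p = injective⇒≤ (AvoidingPath.inj p)

mergeLast : ∀ {s} → Fin (suc (suc s)) → Fin (suc s)
mergeLast {zero}  _        = fzero
mergeLast {suc s} fzero    = fzero
mergeLast {suc s} (fsuc i) = fsuc (mergeLast i)

mergeLast-inject₁ : ∀ {s} (j : Fin (suc s)) → mergeLast (inject₁ j) ≡ j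
mergeLast-inject₁ {zero}  fzero    = refl
mergeLast-inject₁ {suc s} fzero    = refl
mergeLast-inject₁ {suc s} (fsuc j) = cong fsuc (mergeLast-inject₁ j)

fromℕ-or-inject₁ : ∀ {s} (i : Fin (suc s)) → i ≡ fromℕ s ⊎ Σ (Fin s) (λ j → i ≡ inject₁ j)
fromℕ-or-inject₁ {zero}  fzero    = inj₁ refl
fromℕ-or-inject₁ {suc s} fzero    = inj₂ (fzero , refl)
fromℕ-or-inject₁ {suc s} (fsuc i) with fromℕ-or-inject₁ i
... | inj₁ i≡last       = inj₁ (cong fsuc i≡last)
... | inj₂ (j , i≡j)    = inj₂ (fsuc j , cong fsuc i≡j)

Good-initℓ⇒Good : ∀ {s} (ℓ : Fin (suc (suc s)) → ℕ) {n} → Good (initℓ ℓ) n → Good ℓ n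
Good-initℓ⇒Good ℓ good c with good (recolour mergeLast c)
... | j , p = inject₁ j , AvoidingPath-recolour mergeLast c (mergeLast-inject₁ j) p

Good⇒Good-initℓ : ∀ {s} (ℓ : Fin (suc s) → ℕ) {n} → n < lastℓ ℓ → Good ℓ n → Good (initℓ ℓ) n
Good⇒Good-initℓ ℓ n<last good c with good (recolour inject₁ c)
... | i , p with fromℕ-or-inject₁ i
...   | inj₁ refl       = contradiction (AvoidingPath⇒≤ p) (<⇒≱ n<last)
...   | inj₂ (j , refl) = j , AvoidingPath-recolour inject₁ c refl p

IsP-minimal : ∀ {k} {ℓ : Fin k → ℕ} {a n} → IsP ℓ a → Good ℓ n → a ≤ n
IsP-minimal (_ , minimal) good = ≮⇒≥ (λ n<a → minimal _ n<a good)

lemma3 : (s : ℕ) → 2 ≤ s → (ℓ : Fin (suc s) → ℕ) → (∀ i → 2 ≤ ℓ i)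
    → (a b : ℕ) → IsP (initℓ ℓ) a → IsP ℓ b
    → (b ≤ a) × (a ≤ lastℓ ℓ → b ≡ a)
lemma3 (suc s) _ ℓ _ a b (good-a , minimal-a) pb@(good-b , _) = b≤a , b≡a
  where
  b≤a : b ≤ a
  b≤a = IsP-minimal pb (Good-initℓ⇒Good ℓ good-a)

  b≡a : a ≤ lastℓ ℓ → b ≡ a
  b≡a a≤last = ≤-antisym b≤a (≮⇒≥ λ b<a →
    minimal-a b b<a (Good⇒Good-initℓ ℓ (<-≤-trans b<a a≤last) good-b))
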